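{- Let $p=(T_p,W_p,D_p)$ and $q=(T_q,W_q,D_q)$ be in $\mathbb{P}^*$ and let $\delta_p<\delta_q$ be in $C_h$, and suppose that $(p,q)$ is $(\delta_p,\delta_q)$-split. Then: (a) $T_p\cap T_q\subseteq\delta_p$; (b) if $\eta\in\mathrm{dom}(W_p)$ and $\xi\in\mathrm{dom}(W_p)\cap\mathrm{dom}(W_q)$, then $W_p(\eta)\cap W_q(\xi)\subseteq W_p(\xi)$; (c) if $\eta\in\mathrm{dom}(W_q)$ and $\xi\in\mathrm{dom}(W_p)\cap\mathrm{dom}(W_q)$, then $W_q(\eta)\cap W_p(\xi)\subseteq W_q(\xi)$.
   Context: Fix a regular cardinal $\kappa\ge\omega_2$. Define $h:\omega_1\to\omega_1$ by $h(\alpha)=\gamma$ iff $\omega\cdot\gamma\le\alpha<\omega\cdot(\gamma+1)$, and let $C_h$ be the club of $\delta<\omega_1$ closed under $\gamma\mapsto\omega\cdot(\gamma+1)$. A standard finite tree is a pair $(T,<_T)$ where $T$ is a finite subset of $\{0\}\cup(\omega_1\setminus\omega)$, $<_T$ is a strict partial order on $T$ such that for each $x\in T$ the set $\{y:y<_Tx\}$ is linearly ordered by $<_T$, $x<_Ty$ implies $h(x)<h(y)$, and if $T\ne\emptyset$ then $0\in T$ and $0<_Tx$ for all nonzero $x\in T$. For $\delta<\omega_1$, $T\upharpoonright\delta=(T\cap\delta,<_T\cap\delta^2)$. $(U,<_U)$ end-extends $(T,<_T)$ if $T\subseteq U$ and $<_U\cap T^2=<_T$. A subset $W\subseteq T$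 is downwards closed in $T$ if $x\in W$ and $y<_Tx$ imply $y\in W$. A subtree function on $T$ is a function $W$ whose domain is a finite subset of $\kappa$ with each $W(\eta)$ a downwards closed subset of $T$. $\mathbb{P}^*$ is the set of triples $(T,W,D)$ with $T$ a standard finite tree, $W$ a subtree function on $T$, and $D\subseteq[\mathrm{dom}(W)]^2$. For $p,q\in\mathbb{P}^*$ and $\delta_p<\delta_q$ in $C_h$, $(p,q)$ is $(\delta_p,\delta_q)$-split if: (1) $T_p\upharpoonright\delta_p=T_q\upharpoonright\delta_q$; (2) $T_p\subseteq\delta_q$; (3) for all $\eta\in\mathrm{dom}(W_p)\cap\mathrm{dom}(W_q)$, $W_p(\eta)\cap\delta_p=W_q(\eta)\cap\delta_q$; (4) for all distinct $\eta,\xi\in\mathrm{dom}(W_p)\cap\mathrm{dom}(W_q)$, $W_p(\eta)\cap W_p(\xi)\subseteq\delta_p$ and $W_q(\eta)\cap W_q(\xi)\subseteq\delta_q$. -}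

module Defs where

open import Level using (0ℓ)
open import Data.Nat using (ℕ)
open import Data.Product using (Σ; ∃; _×_; _,_)
open import Data.Sum using (_⊎_)
open import Data.List using (List)
open import Data.List.Membership.Propositional using (_∈_)
open import Relation.Nullary using (¬_)
open import Relation.Unary using (Pred)
open import Relation.Binary using (Rel; IsStrictTotalOrder)
open import Induction.WellFounded using (WellFounded)
open import Relation.Binary.PropositionalEquality using (_≡_; _≢_)
open import Function using (Injective; _⇔_)

-- An abstract model of the ordinal ω₁ (together with the ordinal
-- function γ ↦ ω·γ), characterised up to isomorphism:
--  * a well-founded strict total order,
--  * every proper initial segment is countable,
--  * the whole order is uncountable,
--  * ωmul is strictly increasing and its range is exactly the set of
--    ordinals which are 0 or limits, i.e. ωmul is the increasing
--    enumeration of {0} ∪ Lim, which is γ ↦ ω·γ.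

record Omega1 : Set₁ where
  field
    O        : Set
    _<_      : Rel O 0ℓ
    isSTO    : IsStrictTotalOrder _≡_ _<_
    wf       : WellFounded _<_
    zer      : O
    zer-min  : ∀ a → ¬ (a < zer)
    segCountable : ∀ a → Σ (Σ O (λ b → b < a) → ℕ) (Injective _≡_ _≡_)
    uncountable  : ¬ Σ (O → ℕ) (Injective _≡_ _≡_)
    ωmul       : O → O
    ωmul-mono  : ∀ {a b} → a < b → ωmul a < ωmul b
    ωmul-range : ∀ α → (Σ O (λ γ → ωmul γ ≡ α)) ⇔
                       (∀ β → β < α → Σ O (λ γ → β < γ × γ < α))

  _≤_ : Rel O 0ℓ
  a ≤ b = a < b ⊎ a ≡ b

  IsSucc : O → O → Set
  IsSucc γ γ' = γ < γ' × (∀ β → γ < β → ¬ (β < γ'))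

  ω≤ : O → Set
  ω≤ x = Σ O (λ one → IsSucc zer one × ωmul one ≤ x)

  -- h(α) = γ  iff  ω·γ ≤ α < ω·(γ+1)
  H : O → O → Set
  H α γ = ωmul γ ≤ α × (∀ γ' → IsSucc γ γ' → α < ωmul γ')

  InCh : O → Set
  InCh δ = ∀ γ γ' → IsSucc γ γ' → γ < δ → ωmul γ' < δ

module Forcing (Ω : Omega1) (K : Set) where
  open Omega1 Ω

  record Tree : Set₁ where
    field
      T   : List O
      _<T_ : Rel O 0ℓ

  open Tree public

  record IsStandardFiniteTree (t : Tree) : Set where
    field
      T-range   : ∀ x → x ∈ T t → x ≡ zer ⊎ ω≤ x
      <T-domˡ   : ∀ {x y} → _<T_ t x y → x ∈ T t
      <T-domʳ   : ∀ {x y} → _<T_ t x y → y ∈ T t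
      <T-irrefl : ∀ {x} → ¬ (_<T_ t x x)
      <T-trans  : ∀ {x y z} → _<T_ t x y → _<T_ t y z → _<T_ t x z
      <T-linear : ∀ {x y z} → _<T_ t y x → _<T_ t z x →
                  _<T_ t y z ⊎ (y ≡ z ⊎ _<T_ t z y)
      <T-h      : ∀ {x y} → _<T_ t x y → ∀ γx γy → H x γx → H y γy → γx < γy
      root      : ∀ x → x ∈ T t → zer ∈ T t × (∀ y → y ∈ T t → y ≢ zer → _<T_ t zer y)

  -- Elements of ℙ*: (T, W, D).  W is given by its (finite) domain,
  -- a list of elements of κ, and its values W(η) ⊆ T (as predicates).
  record Cond : Set₁ where
    field
      tree : Tree
      domW : List K
      W    : K → Pred O 0ℓ
      D    : List (K × K)

  record InPStar (p : Cond) : Set where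
    open Cond p
    field
      std       : IsStandardFiniteTree tree
      W-sub     : ∀ η → η ∈ domW → ∀ x → W η x → x ∈ T tree
      W-down    : ∀ η → η ∈ domW → ∀ x y → W η x → _<T_ tree y x → W η y
      D-sub     : ∀ η ξ → (η , ξ) ∈ D → η ∈ domW × ξ ∈ domW × η ≢ ξ

  record Split (p q : Cond) (δp δq : O) : Set where
    module P = Cond p
    module Q = Cond q
    field
      split1-set : ∀ x → (x ∈ T P.tree × x < δp) ⇔ (x ∈ T Q.tree × x < δq)
      split1-ord : ∀ x y → (_<T_ P.tree x y × x < δp × y < δp) ⇔
                           (_<T_ Q.tree x y × x < δq × y < δq)
      split2 : ∀ x → x ∈ T P.tree → x < δq
      split3 : ∀ η → η ∈ P.domW → η ∈ Q.domW →
               ∀ x → (P.W η x × x < δp) ⇔ (Q.W η x × x < δq)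
      split4 : ∀ η ξ → η ∈ P.domW → η ∈ Q.domW → ξ ∈ P.domW → ξ ∈ Q.domW →
               η ≢ ξ →
               (∀ x → P.W η x → P.W ξ x → x < δp) ×
               (∀ x → Q.W η x → Q.W ξ x → x < δq)

module Submission where

open import Defs
open import Data.Product using (_×_; _,_; proj₁; proj₂)
open import Data.List.Membership.Propositional using (_∈_)
open import Function.Bundles using (Equivalence)
open import Relation.Binary using (IsStrictTotalOrder)

-- (a) holds because every node of T_p lies below δ_q, so a common node is
-- in T_q ↾ δ_q = T_p ↾ δ_p.  For (b) and (c) the point x is such a common
-- node, hence lies below δ_p, where W_p(ξ) and W_q(ξ) agree by (3).

module SplitLemmas (Ω : Omega1) (K : Set) where
  open Omega1 Ω
  open Forcing Ω K
  open Equivalence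
  open InPStar using (W-sub)

  module _ {p q : Cond} {δp δq : O} (sp : Split p q δp δq) where
    open Split sp

    Split⇒common-node<δp : ∀ x → x ∈ T P.tree → x ∈ T Q.tree → x < δp
    Split⇒common-node<δp x x∈Tp x∈Tq =
      proj₂ (from (split1-set x) (x∈Tq , split2 x x∈Tp))

    module _ {ξ : K} (ξ∈domp : ξ ∈ P.domW) (ξ∈domq : ξ ∈ Q.domW)
             {x : O} (x<δp : x < δp) where

      Split-Wp⇒Wq : P.W ξ x → Q.W ξ x
      Split-Wp⇒Wq wp = proj₁ (to (split3 ξ ξ∈domp ξ∈domq x) (wp , x<δp))

      Split-Wq⇒Wp : δp < δq → Q.W ξ x → P.W ξ x
      Split-Wq⇒Wp δp<δq wq =
        proj₁ (from (split3 ξ ξ∈domp ξ∈domq x)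
                    (wq , IsStrictTotalOrder.trans isSTO x<δp δp<δq))

    module _ (p∈ℙ* : InPStar p) (q∈ℙ* : InPStar q) where

      Split-Wp∩Wq⊆Wp : δp < δq → ∀ η ξ → η ∈ P.domW → ξ ∈ P.domW → ξ ∈ Q.domW →
                       ∀ x → P.W η x → Q.W ξ x → P.W ξ x
      Split-Wp∩Wq⊆Wp δp<δq η ξ η∈domp ξ∈domp ξ∈domq x wpη wqξ =
        Split-Wq⇒Wp ξ∈domp ξ∈domq x<δp δp<δq wqξ
        where
        x<δp : x < δp
        x<δp = Split⇒common-node<δp x (W-sub p∈ℙ* η η∈domp x wpη)
                                      (W-sub q∈ℙ* ξ ξ∈domq x wqξ)

      Split-Wq∩Wp⊆Wq : ∀ η ξ → η ∈ Q.domW → ξ ∈ P.domW → ξ ∈ Q.domW →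
                       ∀ x → Q.W η x → P.W ξ x → Q.W ξ x
      Split-Wq∩Wp⊆Wq η ξ η∈domq ξ∈domp ξ∈domq x wqη wpξ =
        Split-Wp⇒Wq ξ∈domp ξ∈domq x<δp wpξ
        where
        x<δp : x < δp
        x<δp = Split⇒common-node<δp x (W-sub p∈ℙ* ξ ξ∈domp x wpξ)
                                      (W-sub q∈ℙ* η η∈domq x wqη)

lemma2p14 : (Ω : Omega1) (K : Set) →
    let open Omega1 Ω
        open Forcing Ω K
    in (p q : Cond) (δp δq : O) →
       InPStar p → InPStar q → InCh δp → InCh δq → δp < δq →
       Split p q δp δq →
       (∀ x → x ∈ T (Cond.tree p) → x ∈ T (Cond.tree q) → x < δp)
       × (∀ η ξ → η ∈ Cond.domW p → ξ ∈ Cond.domW p → ξ ∈ Cond.domW q →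
            ∀ x → Cond.W p η x → Cond.W q ξ x → Cond.W p ξ x)
       × (∀ η ξ → η ∈ Cond.domW q → ξ ∈ Cond.domW p → ξ ∈ Cond.domW q →
            ∀ x → Cond.W q η x → Cond.W p ξ x → Cond.W q ξ x)
lemma2p14 Ω K p q δp δq p∈ℙ* q∈ℙ* _ _ δp<δq sp =
    Split⇒common-node<δp sp
  , Split-Wp∩Wq⊆Wp sp p∈ℙ* q∈ℙ* δp<δq
  , Split-Wq∩Wp⊆Wq sp p∈ℙ* q∈ℙ*
  where open SplitLemmas Ω K
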